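{- There is a family of Hegselmann–Krause systems, indexed by infinitely many $n$, each with $n$ agents, confidence bound $\varepsilon>0$, social network $G=(V,E)$ with $|E|=\Theta(n^2)$ and initial state $S_0$ with $\Phi(S_0)=\Theta(n^2\varepsilon^2)$, such that for the first uniform random asynchronous update (producing state $S_1$) the expected potential drop satisfies $\mathbb{E}[\Phi(S_0)-\Phi(S_1)]=\Theta(\varepsilon^2/n^3)$.
   Context: A $d$-dimensional Hegselmann–Krause system consists of a finite simple undirected graph $G=(V,E)$ (social network), a confidence bound $\varepsilon>0$, and initial positions $x_v(0)\in\mathbb{R}^d$. In a state, $N(v)=\{u:\{u,v\}\in E,\ \|x_u-x_v\|_2\le\varepsilon\}\cup\{v\}$. A uniform random asynchronous update chooses an agent $v$ uniformly at random from $V$ and replaces $x_v$ by $\frac{1}{|N(v)|}\sum_{u\in N(v)}x_u$, other agents unchanged. The potential of a state is $\Phi(S)=\sum_{\{u,v\}\in E}\min\{\|x_u-x_v\|_2^2,\varepsilon^2\}$. -}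

module Defs where

open import Data.Nat using (ℕ; zero; suc)
open import Data.Fin using (Fin; zero; suc; _<_; _≟_)
open import Data.Bool using (Bool; true; false; if_then_else_; _∧_)
open import Data.Integer using (+_)
open import Data.Rational using (ℚ; 0ℚ; _+_; _-_; _*_; _/_; _⊓_; _≤_)
open import Data.Rational.Properties using (_≤?_)
open import Data.Product using (_×_)
open import Relation.Binary.PropositionalEquality using (_≡_)
open import Relation.Nullary using (¬_; does)

sumFin : (n : ℕ) → (Fin n → ℚ) → ℚ
sumFin zero    f = 0ℚ
sumFin (suc n) f = f zero + sumFin n (λ i → f (suc i))

countFin : (n : ℕ) → (Fin n → Bool) → ℕ
countFin zero    p = zero
countFin (suc n) p = (if p zero then suc else (λ k → k)) (countFin n (λ i → p (suc i)))

sumℕ : (n : ℕ) → (Fin n → ℕ) → ℕ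
sumℕ zero    f = zero
sumℕ (suc n) f = f zero Data.Nat.+ sumℕ n (λ i → f (suc i))
  where import Data.Nat

-- Points of ℝ^d are modelled by rational vectors Fin d → ℚ.
Point : ℕ → Set
Point d = Fin d → ℚ

sqDist : (d : ℕ) → Point d → Point d → ℚ
sqDist d x y = sumFin d (λ k → (x k - y k) * (x k - y k))

record SimpleGraph (n : ℕ) : Set where
  field
    adj   : Fin n → Fin n → Bool
    sym   : ∀ u v → adj u v ≡ adj v u
    irref : ∀ v → adj v v ≡ false
open SimpleGraph public

State : ℕ → ℕ → Set
State n d = Fin n → Point d

numEdges : (n : ℕ) → SimpleGraph n → ℕ
numEdges n G = sumℕ n (λ u → countFin n (λ v → does (u Data.Fin.<? v) ∧ adj G u v))
  where import Data.Fin

potential : (n d : ℕ) → SimpleGraph n → (ε : ℚ) → State n d → ℚ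
potential n d G ε x =
  sumFin n (λ u → sumFin n (λ v →
    if does (u Data.Fin.<? v) ∧ adj G u v
    then sqDist d (x u) (x v) ⊓ (ε * ε)
    else 0ℚ))
  where import Data.Fin

-- u ∈ N(v) \ {v}: u adjacent to v and ‖x_u - x_v‖ ≤ ε (equivalently, since
-- ε > 0, ‖x_u - x_v‖² ≤ ε²).  (v itself is excluded by irreflexivity.)
inNbr : (n d : ℕ) → SimpleGraph n → ℚ → State n d → Fin n → Fin n → Bool
inNbr n d G ε x v u = adj G u v ∧ does (sqDist d (x u) (x v) ≤? (ε * ε))

nbrSize : (n d : ℕ) → SimpleGraph n → ℚ → State n d → Fin n → ℕ
nbrSize n d G ε x v = suc (countFin n (inNbr n d G ε x v))

nbrMean : (n d : ℕ) → SimpleGraph n → ℚ → State n d → Fin n → Point d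
nbrMean n d G ε x v k =
  (x v k + sumFin n (λ u → if inNbr n d G ε x v u then x u k else 0ℚ))
  * ((+ 1) / nbrSize n d G ε x v)

update : (n d : ℕ) → SimpleGraph n → ℚ → State n d → Fin n → State n d
update n d G ε x v w with does (w ≟ v)
... | true  = nbrMean n d G ε x v
... | false = x w

-- Expected potential drop E[Φ(S₀) - Φ(S₁)] under a uniformly random
-- asynchronous update, for n = suc m ≥ 1 agents.
expectedDrop : (m d : ℕ) → SimpleGraph (suc m) → ℚ → State (suc m) d → ℚ
expectedDrop m d G ε x =
  sumFin (suc m) (λ v → potential (suc m) d G ε x - potential (suc m) d G ε (update (suc m) d G ε x v))
  * ((+ 1) / suc m)

{-# OPTIONS --safe #-}

-- With ε = 1, put two agents at distance δ = 1/n joined by an edge, and the other n − 2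
-- agents at 0 and 2 as the two sides of a complete bipartite graph. The bipartite edges
-- are longer than ε: each contributes ε² to Φ, giving Θ(n²) edges and Θ(n²ε²) potential,
-- but they never make agents neighbours, so an update of one of those agents changes
-- nothing. Updating either end of the short edge moves it to the midpoint and cuts that
-- edge's term from δ² to δ²/4, so E[Φ(S₀) − Φ(S₁)] = (2/n)·(3/4)·δ² = 3/(2n³).

module Submission where

open import Defs hiding (sym)
open import Function using (_∘_)
open import Data.Nat using (ℕ; zero; suc)
import Data.Nat as ℕ
import Data.Nat.Properties as ℕP
open import Data.Nat.Coprimality using (1-coprimeTo) renaming (sym to coprime-sym)
import Data.Nat.Tactic.RingSolver as ℕ-Ring
open import Data.Integer using (+_)
import Data.Integer as ℤ
import Data.Integer.Properties as ℤP
open import Data.Fin using (Fin; zero; suc; _<?_; _≟_)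
open import Data.Fin.Properties using (suc-injective)
open import Data.Bool using (Bool; true; false; if_then_else_; _∧_; not; _xor_)
open import Data.Bool.Properties using (xor-comm; xor-same; not-involutive)
open import Data.Rational
  using (ℚ; 0ℚ; 1ℚ; ½; mkℚ; _+_; _-_; _*_; _/_; _≤_; _<_; _⊓_; *≤*; nonNegative)
import Data.Rational.Properties as ℚP
open import Data.Rational.Properties using (_≤?_)
open import Data.Product using (Σ; _×_; _,_)
open import Data.Empty using (⊥-elim)
open import Relation.Nullary using (does; yes; no)
open import Relation.Nullary.Decidable using (toWitness; dec-true)
open import Data.Rational.Solver using (module +-*-Solver)
open import Relation.Binary.PropositionalEquality

ι : ℕ → ℚ
ι a = + a / 1

ι-mkℚ : ∀ a → ι a ≡ mkℚ (+ a) 0 (coprime-sym (1-coprimeTo a))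
ι-mkℚ a = ℚP.normalize-coprime (coprime-sym (1-coprimeTo a))

ι-+ : ∀ a b → ι (a ℕ.+ b) ≡ ι a + ι b
ι-+ a b rewrite ι-mkℚ a | ι-mkℚ b =
  ℚP./-cong {p₁ = + (a ℕ.+ b)} (sym (cong₂ ℤ._+_ (ℤP.*-identityʳ (+ a)) (ℤP.*-identityʳ (+ b)))) refl

ι-* : ∀ a b → ι (a ℕ.* b) ≡ ι a * ι b
ι-* a b rewrite ι-mkℚ a | ι-mkℚ b = ℚP./-cong {p₁ = + (a ℕ.* b)} (ℤP.pos-* a b) refl

ι-mono-≤ : ∀ {a b} → a ℕ.≤ b → ι a ≤ ι b
ι-mono-≤ {a} {b} a≤b rewrite ι-mkℚ a | ι-mkℚ b =
  *≤* (subst₂ ℤ._≤_ (sym (ℤP.*-identityʳ (+ a))) (sym (ℤP.*-identityʳ (+ b))) (ℤ.+≤+ a≤b))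

1/suc : ℕ → ℚ
1/suc m = + 1 / suc m

1/suc-mkℚ : ∀ m → 1/suc m ≡ mkℚ (+ 1) m (1-coprimeTo (suc m))
1/suc-mkℚ m = ℚP.normalize-coprime (1-coprimeTo (suc m))

1/suc-*-ι : ∀ m → 1/suc m * ι (suc m) ≡ 1ℚ
1/suc-*-ι m rewrite 1/suc-mkℚ m | ι-mkℚ (suc m) =
  ℚP.*-inverseˡ (mkℚ (+ suc m) 0 (coprime-sym (1-coprimeTo (suc m))))

0≤1/suc : ∀ m → 0ℚ ≤ 1/suc m
0≤1/suc m rewrite 1/suc-mkℚ m = *≤* (ℤ.+≤+ ℕ.z≤n)

1/suc≤1 : ∀ m → 1/suc m ≤ 1ℚ
1/suc≤1 m rewrite 1/suc-mkℚ m = *≤* (ℤ.+≤+ (ℕ.s≤s ℕ.z≤n))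

1/suc-*-ι-≤ : ∀ q {a b} → a ℕ.≤ suc q ℕ.* b → 1/suc q * ι a ≤ ι b
1/suc-*-ι-≤ q {a} {b} a≤ = begin
  1/suc q * ι a                ≤⟨ ℚP.*-monoˡ-≤-nonNeg (1/suc q) {{nonNegative (0≤1/suc q)}} (ι-mono-≤ a≤) ⟩
  1/suc q * ι (suc q ℕ.* b)    ≡⟨ cong (1/suc q *_) (ι-* (suc q) b) ⟩
  1/suc q * (ι (suc q) * ι b)  ≡⟨ sym (ℚP.*-assoc (1/suc q) (ι (suc q)) (ι b)) ⟩
  1/suc q * ι (suc q) * ι b    ≡⟨ cong (_* ι b) (1/suc-*-ι q) ⟩
  1ℚ * ι b                     ≡⟨ ℚP.*-identityˡ (ι b) ⟩
  ι b                          ∎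
  where open ℚP.≤-Reasoning

square≤1 : ∀ {t} → 0ℚ ≤ t → t ≤ 1ℚ → t * t ≤ 1ℚ
square≤1 {t} 0≤t t≤1 = ℚP.≤-trans (ℚP.*-monoˡ-≤-nonNeg t {{nonNegative 0≤t}} t≤1)
                                  (subst (_≤ 1ℚ) (sym (ℚP.*-identityʳ t)) t≤1)

0≤square : ∀ {t} → 0ℚ ≤ t → 0ℚ ≤ t * t
0≤square {t} 0≤t = ℚP.nonNegative⁻¹ (t * t) {{ℚP.nonNeg*nonNeg⇒nonNeg t {{nonNegative 0≤t}} t {{nonNegative 0≤t}}}}

sumFin-cong : ∀ n {f g : Fin n → ℚ} → (∀ i → f i ≡ g i) → sumFin n f ≡ sumFin n g
sumFin-cong zero    f≡g = refl
sumFin-cong (suc n) f≡g = cong₂ _+_ (f≡g zero) (sumFin-cong n (f≡g ∘ suc))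

sumFin-zero : ∀ n → sumFin n (λ _ → 0ℚ) ≡ 0ℚ
sumFin-zero zero    = refl
sumFin-zero (suc n) = trans (ℚP.+-identityˡ _) (sumFin-zero n)

sumFin-ι : ∀ n (f : Fin n → ℕ) → sumFin n (ι ∘ f) ≡ ι (sumℕ n f)
sumFin-ι zero    f = refl
sumFin-ι (suc n) f = trans (cong (_+_ (ι (f zero))) (sumFin-ι n (f ∘ suc))) (sym (ι-+ (f zero) _))

sumFin-single : ∀ n (p : Fin n → Bool) (f : Fin n → ℚ) u₀ → p u₀ ≡ true →
                (∀ u → u ≢ u₀ → p u ≡ false) →
                sumFin n (λ u → if p u then f u else 0ℚ) ≡ f u₀
sumFin-single (suc n) p f zero pu₀ others rewrite pu₀ =
  trans (cong (_+_ (f zero)) (trans (sumFin-cong n (λ u → cong (if_then f (suc u) else 0ℚ) (others (suc u) λ ())))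
                                 (sumFin-zero n)))
        (ℚP.+-identityʳ (f zero))
sumFin-single (suc n) p f (suc u₀) pu₀ others rewrite others zero (λ ()) =
  trans (ℚP.+-identityˡ _)
        (sumFin-single n (p ∘ suc) (f ∘ suc) u₀ pu₀ (λ u u≢u₀ → others (suc u) (u≢u₀ ∘ suc-injective)))

sumFin-if-⊓ : ∀ n (b : Fin n → Bool) (g : Fin n → ℚ) K → (∀ j → b j ≡ true → K ≤ g j) →
              sumFin n (λ j → if b j then g j ⊓ K else 0ℚ) ≡ ι (countFin n b) * K
sumFin-if-⊓ zero    b g K far = sym (ℚP.*-zeroˡ K)
sumFin-if-⊓ (suc n) b g K far with b zero in b₀
... | true = begin
  g zero ⊓ K + rest          ≡⟨ cong₂ _+_ (ℚP.p≥q⇒p⊓q≡q (far zero b₀)) IH ⟩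
  K + ι count * K            ≡⟨ cong (_+ ι count * K) (ℚP.*-identityˡ K) ⟨
  1ℚ * K + ι count * K       ≡⟨ ℚP.*-distribʳ-+ K 1ℚ (ι count) ⟨
  (1ℚ + ι count) * K         ≡⟨ cong (_* K) (ι-+ 1 count) ⟨
  ι (suc count) * K          ∎
  where
  open ≡-Reasoning
  rest  = sumFin n (λ j → if b (suc j) then g (suc j) ⊓ K else 0ℚ)
  count = countFin n (b ∘ suc)
  IH : rest ≡ ι count * K
  IH = sumFin-if-⊓ n (b ∘ suc) (g ∘ suc) K (far ∘ suc)
... | false = trans (ℚP.+-identityˡ _) (sumFin-if-⊓ n (b ∘ suc) (g ∘ suc) K (far ∘ suc))

countFin-cong : ∀ n {p q : Fin n → Bool} → (∀ i → p i ≡ q i) → countFin n p ≡ countFin n q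
countFin-cong zero    p≡q = refl
countFin-cong (suc n) p≡q rewrite p≡q zero | countFin-cong n (p≡q ∘ suc) = refl

countFin-false : ∀ n → countFin n (λ _ → false) ≡ 0
countFin-false zero    = refl
countFin-false (suc n) = countFin-false n

countFin-single : ∀ n (p : Fin n → Bool) u₀ → p u₀ ≡ true → (∀ u → u ≢ u₀ → p u ≡ false) →
                  countFin n p ≡ 1
countFin-single (suc n) p zero pu₀ others
  rewrite pu₀ = cong suc (trans (countFin-cong n (λ u → others (suc u) λ ())) (countFin-false n))
countFin-single (suc n) p (suc u₀) pu₀ others rewrite others zero (λ ()) =
  countFin-single n (p ∘ suc) u₀ pu₀ (λ u u≢u₀ → others (suc u) (u≢u₀ ∘ suc-injective))

countFin-≤ : ∀ n (p : Fin n → Bool) → countFin n p ℕ.≤ n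
countFin-≤ zero    p = ℕ.z≤n
countFin-≤ (suc n) p with p zero
... | true  = ℕ.s≤s (countFin-≤ n (p ∘ suc))
... | false = ℕP.m≤n⇒m≤1+n (countFin-≤ n (p ∘ suc))

countFin-+-not : ∀ n (p : Fin n → Bool) → countFin n p ℕ.+ countFin n (not ∘ p) ≡ n
countFin-+-not zero    p = refl
countFin-+-not (suc n) p with p zero
... | true  = cong suc (countFin-+-not n (p ∘ suc))
... | false = trans (ℕP.+-suc _ _) (cong suc (countFin-+-not n (p ∘ suc)))

sumℕ-cong : ∀ n {f g : Fin n → ℕ} → (∀ i → f i ≡ g i) → sumℕ n f ≡ sumℕ n g
sumℕ-cong zero    f≡g = refl
sumℕ-cong (suc n) f≡g = cong₂ ℕ._+_ (f≡g zero) (sumℕ-cong n (f≡g ∘ suc))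

sumℕ-≤ : ∀ n {k} (f : Fin n → ℕ) → (∀ i → f i ℕ.≤ k) → sumℕ n f ℕ.≤ n ℕ.* k
sumℕ-≤ zero    f f≤k = ℕ.z≤n
sumℕ-≤ (suc n) f f≤k = ℕP.+-mono-≤ (f≤k zero) (sumℕ-≤ n (f ∘ suc) (f≤k ∘ suc))

_≋_ : ∀ {n d} → State n d → State n d → Set
x ≋ y = ∀ w k → x w k ≡ y w k

potential-cong : ∀ n d G ε (x y : State n d) → x ≋ y → potential n d G ε x ≡ potential n d G ε y
potential-cong n d G ε x y x≋y = sumFin-cong n λ u → sumFin-cong n λ v →
  cong (λ q → if does (u <? v) ∧ adj G u v then q ⊓ (ε * ε) else 0ℚ)
       (sumFin-cong d λ k → cong₂ (λ p q → (p - q) * (p - q)) (x≋y u k) (x≋y v k))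

numEdges-≤ : ∀ n G → numEdges n G ℕ.≤ n ℕ.* n
numEdges-≤ n G = sumℕ-≤ n _ (λ u → countFin-≤ n _)

module Dynamics (n d : ℕ) (G : SimpleGraph n) (ε : ℚ) (x : State n d) (v : Fin n) where

  nbrMean-isolated : (∀ u → inNbr n d G ε x v u ≡ false) → ∀ k → nbrMean n d G ε x v k ≡ x v k
  nbrMean-isolated none k
    rewrite countFin-cong n none | countFin-false n
          | sumFin-cong n (λ u → cong (if_then x u k else 0ℚ) (none u)) | sumFin-zero n
    = trans (ℚP.*-identityʳ _) (ℚP.+-identityʳ _)

  nbrMean-unique : ∀ u₀ → inNbr n d G ε x v u₀ ≡ true → (∀ u → u ≢ u₀ → inNbr n d G ε x v u ≡ false) →
                   ∀ k → nbrMean n d G ε x v k ≡ (x v k + x u₀ k) * ½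
  nbrMean-unique u₀ close others k
    rewrite countFin-single n (inNbr n d G ε x v) u₀ close others
          | sumFin-single n (inNbr n d G ε x v) (λ u → x u k) u₀ close others = refl

  update-≋ : (y : State n d) → (∀ k → nbrMean n d G ε x v k ≡ y v k) → (∀ w → w ≢ v → ∀ k → x w k ≡ y w k) →
             update n d G ε x v ≋ y
  update-≋ y moved fixed w k with w ≟ v
  ... | yes refl = moved k
  ... | no  w≢v  = fixed w w≢v k

-- Two clusters at distance 2 > ε = 1

side : Bool → ℚ
side false = 0ℚ
side true  = ι 2

sides-far : ∀ a b b' → a ∧ (b xor b') ≡ true →
            1ℚ ≤ sqDist 1 (λ _ → side b) (λ _ → side b')
sides-far true false true  _ = toWitness {a? = 1ℚ ≤? _} _
sides-far true true  false _ = toWitness {a? = 1ℚ ≤? _} _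

sides-not-close : ∀ b b' → (b xor b') ∧ does (sqDist 1 (λ _ → side b) (λ _ → side b') ≤? 1ℚ * 1ℚ) ≡ false
sides-not-close false false = refl
sides-not-close false true  = refl
sides-not-close true  false = refl
sides-not-close true  true  = refl

crossPairs : (k : ℕ) → (Fin k → Bool) → ℕ
crossPairs k c = sumℕ k (λ i → countFin k (λ j → does (i <? j) ∧ (c i xor c j)))

crossPairs-not : ∀ k (c : Fin k → Bool) → crossPairs k (not ∘ c) ≡ crossPairs k c
crossPairs-not k c = sumℕ-cong k λ i → countFin-cong k λ j → cong (does (i <? j) ∧_) (not-xor-not (c i) (c j))
  where
  not-xor-not : ∀ a b → not a xor not b ≡ a xor b
  not-xor-not false b = not-involutive b
  not-xor-not true  b = refl

cutPotential : ∀ k (c : Fin k → Bool) →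
  sumFin k (λ i → sumFin k (λ j → if does (i <? j) ∧ (c i xor c j)
                                   then sqDist 1 (λ _ → side (c i)) (λ _ → side (c j)) ⊓ 1ℚ else 0ℚ))
  ≡ ι (crossPairs k c)
cutPotential k c =
  trans (sumFin-cong k λ i → trans (sumFin-if-⊓ k _ _ 1ℚ (λ j → sides-far _ (c i) (c j))) (ℚP.*-identityʳ _))
        (sumFin-ι k _)

-- A pendant edge beside a complete bipartite graph

module PendantEdgeAndBipartite (k : ℕ) (c : Fin k → Bool) where

  adjacency : Fin (2 ℕ.+ k) → Fin (2 ℕ.+ k) → Bool
  adjacency zero          (suc zero)    = true
  adjacency (suc zero)    zero          = true
  adjacency (suc (suc i)) (suc (suc j)) = c i xor c j
  adjacency _             _             = false

  adjacency-sym : ∀ u v → adjacency u v ≡ adjacency v u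
  adjacency-sym zero          zero          = refl
  adjacency-sym zero          (suc zero)    = refl
  adjacency-sym zero          (suc (suc j)) = refl
  adjacency-sym (suc zero)    zero          = refl
  adjacency-sym (suc zero)    (suc zero)    = refl
  adjacency-sym (suc zero)    (suc (suc j)) = refl
  adjacency-sym (suc (suc i)) zero          = refl
  adjacency-sym (suc (suc i)) (suc zero)    = refl
  adjacency-sym (suc (suc i)) (suc (suc j)) = xor-comm (c i) (c j)

  adjacency-irrefl : ∀ v → adjacency v v ≡ false
  adjacency-irrefl zero          = refl
  adjacency-irrefl (suc zero)    = refl
  adjacency-irrefl (suc (suc i)) = xor-same (c i)

  graph : SimpleGraph (2 ℕ.+ k)
  graph = record { adj = adjacency ; sym = adjacency-sym ; irref = adjacency-irrefl }

  config : ℚ → ℚ → State (2 ℕ.+ k) 1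
  config a b zero          _ = a
  config a b (suc zero)    _ = b
  config a b (suc (suc j)) _ = side (c j)

  Φ : State (2 ℕ.+ k) 1 → ℚ
  Φ = potential (2 ℕ.+ k) 1 graph 1ℚ

  step : State (2 ℕ.+ k) 1 → Fin (2 ℕ.+ k) → State (2 ℕ.+ k) 1
  step = update (2 ℕ.+ k) 1 graph 1ℚ

  open Dynamics (2 ℕ.+ k) 1 graph 1ℚ

  numEdges-graph : numEdges (2 ℕ.+ k) graph ≡ suc (crossPairs k c)
  numEdges-graph = cong₂ (λ p q → suc p ℕ.+ (q ℕ.+ crossPairs k c)) (countFin-false k) (countFin-false k)

  potential-config : ∀ a b → Φ (config a b) ≡ sqDist 1 (λ _ → a) (λ _ → b) ⊓ 1ℚ + ι (crossPairs k c)
  potential-config a b = begin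
    Φ (config a b)
      ≡⟨⟩ -- row 0 holds the pendant edge, row 1 nothing, row 2 + i the bipartite edges at i
    (0ℚ + (s + sumFin k (λ _ → 0ℚ))) + ((0ℚ + (0ℚ + sumFin k (λ _ → 0ℚ))) + sumFin k (λ i → 0ℚ + (0ℚ + R i)))
      ≡⟨ cong₂ (λ z t → (0ℚ + (s + z)) + ((0ℚ + (0ℚ + z)) + t)) (sumFin-zero k)
               (sumFin-cong k λ i → trans (ℚP.+-identityˡ _) (ℚP.+-identityˡ (R i))) ⟩
    (0ℚ + (s + 0ℚ)) + (0ℚ + sumFin k R)
      ≡⟨ cong₂ _+_ (trans (ℚP.+-identityˡ _) (ℚP.+-identityʳ s)) (ℚP.+-identityˡ _) ⟩
    s + sumFin k R
      ≡⟨ cong (_+_ s) (cutPotential k c) ⟩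
    s + ι (crossPairs k c) ∎
    where
    open ≡-Reasoning
    s = sqDist 1 (λ _ → a) (λ _ → b) ⊓ 1ℚ
    R : Fin k → ℚ
    R i = sumFin k (λ j → if does (i <? j) ∧ (c i xor c j)
                          then sqDist 1 (λ _ → side (c i)) (λ _ → side (c j)) ⊓ 1ℚ else 0ℚ)

  module _ (a b : ℚ) where

    update-left : sqDist 1 (λ _ → b) (λ _ → a) ≤ 1ℚ → step (config a b) zero ≋ config ((a + b) * ½) b
    update-left close = update-≋ (config a b) zero _
      (nbrMean-unique (config a b) zero (suc zero) (dec-true (_ ≤? _) close) others)
      (λ { zero w≢0 → ⊥-elim (w≢0 refl) ; (suc zero) _ _ → refl ; (suc (suc _)) _ _ → refl })
      where
      others : ∀ u → u ≢ suc zero → inNbr (2 ℕ.+ k) 1 graph 1ℚ (config a b) zero u ≡ false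
      others zero          _   = refl
      others (suc zero)    u≢1 = ⊥-elim (u≢1 refl)
      others (suc (suc j)) _   = refl

    update-right : sqDist 1 (λ _ → a) (λ _ → b) ≤ 1ℚ → step (config a b) (suc zero) ≋ config a ((b + a) * ½)
    update-right close = update-≋ (config a b) (suc zero) _
      (nbrMean-unique (config a b) (suc zero) zero (dec-true (_ ≤? _) close) others)
      (λ { zero _ _ → refl ; (suc zero) w≢1 → ⊥-elim (w≢1 refl) ; (suc (suc _)) _ _ → refl })
      where
      others : ∀ u → u ≢ zero → inNbr (2 ℕ.+ k) 1 graph 1ℚ (config a b) (suc zero) u ≡ false
      others zero          u≢0 = ⊥-elim (u≢0 refl)
      others (suc zero)    _   = refl
      others (suc (suc j)) _   = refl

    update-bipartite : ∀ j → step (config a b) (suc (suc j)) ≋ config a b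
    update-bipartite j =
      update-≋ (config a b) (suc (suc j)) _ (nbrMean-isolated (config a b) (suc (suc j)) isolated) (λ _ _ _ → refl)
      where
      isolated : ∀ u → inNbr (2 ℕ.+ k) 1 graph 1ℚ (config a b) (suc (suc j)) u ≡ false
      isolated zero          = refl
      isolated (suc zero)    = refl
      isolated (suc (suc i)) = sides-not-close (c i) (c j)

  potential-close : ∀ a b t → 0ℚ ≤ t → t ≤ 1ℚ → sqDist 1 (λ _ → a) (λ _ → b) ≡ t * t →
                    Φ (config a b) ≡ t * t + ι (crossPairs k c)
  potential-close a b t 0≤t t≤1 sq≡ =
    trans (potential-config a b)
          (cong (_+ ι (crossPairs k c)) (trans (cong (_⊓ 1ℚ) sq≡) (ℚP.p≤q⇒p⊓q≡p (square≤1 0≤t t≤1))))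

  module _ (δ : ℚ) (0≤δ : 0ℚ ≤ δ) (δ≤1 : δ ≤ 1ℚ) where

    x₀ : State (2 ℕ.+ k) 1
    x₀ = config δ 0ℚ

    drop : Fin (2 ℕ.+ k) → ℚ
    drop v = Φ x₀ - Φ (step x₀ v)

    private
      open +-*-Solver
      C = ι (crossPairs k c)
      h = δ * ½

      0≤h : 0ℚ ≤ h
      0≤h = ℚP.nonNegative⁻¹ h {{ℚP.nonNeg*nonNeg⇒nonNeg δ {{nonNegative 0≤δ}} ½}}

      h≤1 : h ≤ 1ℚ
      h≤1 = ℚP.≤-trans (ℚP.*-monoʳ-≤-nonNeg ½ δ≤1) (toWitness {a? = 1ℚ * ½ ≤? 1ℚ} _)

      sq-δ0 : ∀ δ → (δ - 0ℚ) * (δ - 0ℚ) + 0ℚ ≡ δ * δ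
      sq-δ0 = solve 1 (λ δ → (δ :- con 0ℚ) :* (δ :- con 0ℚ) :+ con 0ℚ := δ :* δ) refl
      sq-0δ : ∀ δ → (0ℚ - δ) * (0ℚ - δ) + 0ℚ ≡ δ * δ
      sq-0δ = solve 1 (λ δ → (con 0ℚ :- δ) :* (con 0ℚ :- δ) :+ con 0ℚ := δ :* δ) refl
      sq-left : ∀ δ → ((δ + 0ℚ) * ½ - 0ℚ) * ((δ + 0ℚ) * ½ - 0ℚ) + 0ℚ ≡ (δ * ½) * (δ * ½)
      sq-left = solve 1 (λ δ → ((δ :+ con 0ℚ) :* con ½ :- con 0ℚ) :* ((δ :+ con 0ℚ) :* con ½ :- con 0ℚ) :+ con 0ℚ
                              := (δ :* con ½) :* (δ :* con ½)) refl
      sq-right : ∀ δ → (δ - (0ℚ + δ) * ½) * (δ - (0ℚ + δ) * ½) + 0ℚ ≡ (δ * ½) * (δ * ½)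
      sq-right = solve 1 (λ δ → (δ :- (con 0ℚ :+ δ) :* con ½) :* (δ :- (con 0ℚ :+ δ) :* con ½) :+ con 0ℚ
                               := (δ :* con ½) :* (δ :* con ½)) refl

    Φ-initial : Φ x₀ ≡ δ * δ + C
    Φ-initial = potential-close δ 0ℚ δ 0≤δ δ≤1 (sq-δ0 δ)

    Φ-after-left : Φ (step x₀ zero) ≡ h * h + C
    Φ-after-left =
      trans (potential-cong _ _ graph 1ℚ _ _ (update-left δ 0ℚ (subst (_≤ 1ℚ) (sym (sq-0δ δ)) (square≤1 0≤δ δ≤1))))
            (potential-close ((δ + 0ℚ) * ½) 0ℚ h 0≤h h≤1 (sq-left δ))

    Φ-after-right : Φ (step x₀ (suc zero)) ≡ h * h + C
    Φ-after-right =
      trans (potential-cong _ _ graph 1ℚ _ _ (update-right δ 0ℚ (subst (_≤ 1ℚ) (sym (sq-δ0 δ)) (square≤1 0≤δ δ≤1))))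
            (potential-close δ ((0ℚ + δ) * ½) h 0≤h h≤1 (sq-right δ))

    drop-bipartite : ∀ j → drop (suc (suc j)) ≡ 0ℚ
    drop-bipartite j =
      trans (cong (Φ x₀ -_) (potential-cong _ _ graph 1ℚ (step x₀ (suc (suc j))) x₀ (update-bipartite δ 0ℚ j)))
            (ℚP.+-inverseʳ (Φ x₀))

    sum-drops : sumFin (2 ℕ.+ k) drop ≡ + 3 / 2 * (δ * δ)
    sum-drops = begin
      drop zero + (drop (suc zero) + sumFin k (λ j → drop (suc (suc j))))
        ≡⟨ cong₂ _+_ (cong₂ _-_ Φ-initial Φ-after-left)
                     (cong₂ _+_ (cong₂ _-_ Φ-initial Φ-after-right)
                                (trans (sumFin-cong k {f = λ j → drop (suc (suc j))} drop-bipartite) (sumFin-zero k))) ⟩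
      (δ * δ + C - (h * h + C)) + ((δ * δ + C - (h * h + C)) + 0ℚ)
        ≡⟨ arith δ C ⟩
      + 3 / 2 * (δ * δ) ∎
      where
      open ≡-Reasoning
      arith : ∀ δ C → (δ * δ + C - ((δ * ½) * (δ * ½) + C)) + ((δ * δ + C - ((δ * ½) * (δ * ½) + C)) + 0ℚ)
                      ≡ + 3 / 2 * (δ * δ)
      arith = solve 2 (λ δ C → (δ :* δ :+ C :- ((δ :* con ½) :* (δ :* con ½) :+ C))
                               :+ ((δ :* δ :+ C :- ((δ :* con ½) :* (δ :* con ½) :+ C)) :+ con 0ℚ)
                               := con (+ 3 / 2) :* (δ :* δ)) refl

-- Bipartition by parity

odd : ∀ {k} → Fin k → Bool
odd zero    = false
odd (suc i) = not (odd i)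

parityPairs : ℕ → ℕ
parityPairs k = crossPairs k odd

parityPairs-suc : ∀ k → parityPairs (suc k) ≡ countFin k (not ∘ odd) ℕ.+ parityPairs k
parityPairs-suc k = cong (countFin k (not ∘ odd) ℕ.+_) (crossPairs-not k odd)

parityPairs-+2 : ∀ k → parityPairs (2 ℕ.+ k) ≡ suc k ℕ.+ parityPairs k
parityPairs-+2 k = begin
  parityPairs (2 ℕ.+ k)                        ≡⟨ parityPairs-suc (suc k) ⟩
  evens (suc k) ℕ.+ parityPairs (suc k)        ≡⟨ cong (evens (suc k) ℕ.+_) (parityPairs-suc k) ⟩
  evens (suc k) ℕ.+ (evens k ℕ.+ parityPairs k) ≡⟨ ℕP.+-assoc (evens (suc k)) (evens k) _ ⟨
  evens (suc k) ℕ.+ evens k ℕ.+ parityPairs k   ≡⟨ cong (ℕ._+ parityPairs k) evens-+ ⟩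
  suc k ℕ.+ parityPairs k                      ∎
  where
  open ≡-Reasoning
  evens : ℕ → ℕ
  evens n = countFin n (not ∘ odd)
  evens-+ : evens (suc k) ℕ.+ evens k ≡ suc k
  evens-+ = cong suc (trans (cong (ℕ._+ evens k) (countFin-cong k (not-involutive ∘ odd))) (countFin-+-not k odd))

parityPairs-lower : ∀ k → (4 ℕ.+ k) ℕ.* (4 ℕ.+ k) ℕ.≤ 16 ℕ.* parityPairs (2 ℕ.+ k)
parityPairs-lower zero          = ℕP.≤-refl
parityPairs-lower (suc zero)    = ℕP.m≤m+n 25 7
parityPairs-lower (suc (suc k)) = begin
  (6 ℕ.+ k) ℕ.* (6 ℕ.+ k)                             ≡⟨ square-step k ⟩
  (4 ℕ.* k ℕ.+ 20) ℕ.+ (4 ℕ.+ k) ℕ.* (4 ℕ.+ k)          ≤⟨ ℕP.+-mono-≤ linear (parityPairs-lower k) ⟩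
  16 ℕ.* (3 ℕ.+ k) ℕ.+ 16 ℕ.* parityPairs (2 ℕ.+ k)     ≡⟨ ℕP.*-distribˡ-+ 16 (3 ℕ.+ k) _ ⟨
  16 ℕ.* (3 ℕ.+ k ℕ.+ parityPairs (2 ℕ.+ k))           ≡⟨ cong (16 ℕ.*_) (parityPairs-+2 (2 ℕ.+ k)) ⟨
  16 ℕ.* parityPairs (4 ℕ.+ k)                        ∎
  where
  open ℕP.≤-Reasoning
  square-step : ∀ k → (6 ℕ.+ k) ℕ.* (6 ℕ.+ k) ≡ (4 ℕ.* k ℕ.+ 20) ℕ.+ (4 ℕ.+ k) ℕ.* (4 ℕ.+ k)
  square-step = ℕ-Ring.solve-∀
  slack : ∀ k → (4 ℕ.* k ℕ.+ 20) ℕ.+ (12 ℕ.* k ℕ.+ 28) ≡ 16 ℕ.* (3 ℕ.+ k)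
  slack = ℕ-Ring.solve-∀
  linear : 4 ℕ.* k ℕ.+ 20 ℕ.≤ 16 ℕ.* (3 ℕ.+ k)
  linear = ℕP.≤-trans (ℕP.m≤m+n _ _) (ℕP.≤-reflexive (slack k))

module Example (N : ℕ) where

  open PendantEdgeAndBipartite (2 ℕ.+ N) odd public

  δ : ℚ
  δ = 1/suc (3 ℕ.+ N)

  ν : ℚ
  ν = ι (4 ℕ.+ N)

  0≤δ : 0ℚ ≤ δ
  0≤δ = 0≤1/suc (3 ℕ.+ N)

  δ≤1 : δ ≤ 1ℚ
  δ≤1 = 1/suc≤1 (3 ℕ.+ N)

  initial : State (4 ℕ.+ N) 1
  initial = x₀ δ 0≤δ δ≤1

  edges : ℚ
  edges = ι (numEdges (4 ℕ.+ N) graph)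

  ι-square : ι ((4 ℕ.+ N) ℕ.* (4 ℕ.+ N)) ≡ ν * ν
  ι-square = ι-* (4 ℕ.+ N) (4 ℕ.+ N)

  square/16≤parityPairs : 1/suc 15 * (ν * ν) ≤ ι (parityPairs (2 ℕ.+ N))
  square/16≤parityPairs =
    subst (λ q → 1/suc 15 * q ≤ ι (parityPairs (2 ℕ.+ N))) ι-square
          (1/suc-*-ι-≤ 15 {b = parityPairs (2 ℕ.+ N)} (parityPairs-lower N))

  edges-lower : 1/suc 15 * (ν * ν) ≤ edges
  edges-lower = begin
    1/suc 15 * (ν * ν)              ≤⟨ square/16≤parityPairs ⟩
    ι (parityPairs (2 ℕ.+ N))       ≤⟨ ι-mono-≤ (ℕP.n≤1+n (parityPairs (2 ℕ.+ N))) ⟩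
    ι (suc (parityPairs (2 ℕ.+ N))) ≡⟨ cong ι numEdges-graph ⟨
    edges                           ∎
    where open ℚP.≤-Reasoning

  edges-upper : edges ≤ 1ℚ * (ν * ν)
  edges-upper = begin
    edges                             ≤⟨ ι-mono-≤ (numEdges-≤ (4 ℕ.+ N) graph) ⟩
    ι ((4 ℕ.+ N) ℕ.* (4 ℕ.+ N))       ≡⟨ trans ι-square (sym (ℚP.*-identityˡ _)) ⟩
    1ℚ * (ν * ν)                      ∎
    where open ℚP.≤-Reasoning

  potential-lower : 1/suc 15 * (ν * ν * (1ℚ * 1ℚ)) ≤ Φ initial
  potential-lower = begin
    1/suc 15 * (ν * ν * 1ℚ)          ≡⟨ cong (1/suc 15 *_) (ℚP.*-identityʳ (ν * ν)) ⟩
    1/suc 15 * (ν * ν)               ≤⟨ square/16≤parityPairs ⟩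
    ι (parityPairs (2 ℕ.+ N))        ≡⟨ ℚP.+-identityˡ _ ⟨
    0ℚ + ι (parityPairs (2 ℕ.+ N))   ≤⟨ ℚP.+-monoˡ-≤ _ (0≤square 0≤δ) ⟩
    δ * δ + ι (parityPairs (2 ℕ.+ N)) ≡⟨ Φ-initial δ 0≤δ δ≤1 ⟨
    Φ initial                        ∎
    where open ℚP.≤-Reasoning

  potential-upper : Φ initial ≤ 1ℚ * (ν * ν * (1ℚ * 1ℚ))
  potential-upper = begin
    Φ initial                        ≡⟨ Φ-initial δ 0≤δ δ≤1 ⟩
    δ * δ + ι (parityPairs (2 ℕ.+ N)) ≤⟨ ℚP.+-monoˡ-≤ _ (square≤1 0≤δ δ≤1) ⟩
    1ℚ + ι (parityPairs (2 ℕ.+ N))   ≡⟨ trans (cong ι numEdges-graph) (ι-+ 1 (parityPairs (2 ℕ.+ N))) ⟨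
    edges                            ≤⟨ edges-upper ⟩
    1ℚ * (ν * ν)                     ≡⟨ cong (1ℚ *_) (ℚP.*-identityʳ (ν * ν)) ⟨
    1ℚ * (ν * ν * 1ℚ)                ∎
    where open ℚP.≤-Reasoning

  scaled-expected-drop : expectedDrop (3 ℕ.+ N) 1 graph 1ℚ initial * (ν * ν * ν) ≡ + 3 / 2
  scaled-expected-drop = begin
    sumFin (4 ℕ.+ N) (drop δ 0≤δ δ≤1) * δ * (ν * ν * ν) ≡⟨ cong (λ s → s * δ * (ν * ν * ν)) (sum-drops δ 0≤δ δ≤1) ⟩
    + 3 / 2 * (δ * δ) * δ * (ν * ν * ν)              ≡⟨ cube δ ν ⟩
    + 3 / 2 * ((δ * ν) * ((δ * ν) * (δ * ν)))        ≡⟨ cong (λ t → + 3 / 2 * (t * (t * t))) (1/suc-*-ι (3 ℕ.+ N)) ⟩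
    + 3 / 2                                          ∎
    where
    open ≡-Reasoning
    open +-*-Solver
    cube : ∀ δ ν → + 3 / 2 * (δ * δ) * δ * (ν * ν * ν) ≡ + 3 / 2 * ((δ * ν) * ((δ * ν) * (δ * ν)))
    cube = solve 2 (λ δ ν → con (+ 3 / 2) :* (δ :* δ) :* δ :* (ν :* ν :* ν)
                            := con (+ 3 / 2) :* ((δ :* ν) :* ((δ :* ν) :* (δ :* ν)))) refl

theorem3 : Σ ℚ λ a₁ → Σ ℚ λ a₂ → Σ ℚ λ b₁ → Σ ℚ λ b₂ → Σ ℚ λ c₁ → Σ ℚ λ c₂ →
    (0ℚ < a₁) × (0ℚ < a₂) × (0ℚ < b₁) × (0ℚ < b₂) × (0ℚ < c₁) × (0ℚ < c₂) ×
    ((N : ℕ) → Σ ℕ λ m → (N Data.Nat.≤ suc m) × Σ ℕ λ d → Σ ℚ λ ε →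
      Σ (SimpleGraph (suc m)) λ G → Σ (State (suc m) d) λ x₀ →
        let n  = (+ suc m) / 1
            e2 = ε * ε
            Φ₀ = potential (suc m) d G ε x₀
            D  = expectedDrop m d G ε x₀
        in (0ℚ < ε)
         × ((a₁ * (n * n) ≤ (+ numEdges (suc m) G) / 1) × ((+ numEdges (suc m) G) / 1 ≤ a₂ * (n * n)))
         × ((b₁ * (n * n * e2) ≤ Φ₀) × (Φ₀ ≤ b₂ * (n * n * e2)))
         × ((c₁ * e2 ≤ D * (n * n * n)) × (D * (n * n * n) ≤ c₂ * e2)))
theorem3 =
  1/suc 15 , 1ℚ , 1/suc 15 , 1ℚ , + 3 / 2 , + 3 / 2 ,
  ℚP.positive⁻¹ _ , ℚP.positive⁻¹ _ , ℚP.positive⁻¹ _ , ℚP.positive⁻¹ _ , ℚP.positive⁻¹ _ , ℚP.positive⁻¹ _ ,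
  λ N → let open Example N in
    3 ℕ.+ N , ℕP.m≤n+m N 4 , 1 , 1ℚ , graph , initial , ℚP.positive⁻¹ _ ,
    (edges-lower , edges-upper) ,
    (potential-lower , potential-upper) ,
    (ℚP.≤-reflexive (sym scaled-expected-drop) , ℚP.≤-reflexive scaled-expected-drop)
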